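{- For every prime $p$ and every positive integer $n$ divisible by $p$, $$K(n,p)\ge\frac{p^n[(n/p)!]^p}{n!}.$$ Consequently, for every fixed prime $p$, as $n\to\infty$ over multiples of $p$, $$K(n,p)\ge(1+o(1))\frac{(2\pi)^{(p-1)/2}}{p^{p/2}}\,n^{(p-1)/2}.$$
   Context: Let $p$ be a prime, $w_1=e^{2\pi i/p}$, and $w_j=w_1^j$ for $0\le j\le p-1$. For $n$ divisible by $p$, let $B$ be the set of all $p^n$ vectors of length $n$ with every coordinate in $\{1,w_1,\dots,w_{p-1}\}$. $K(n,p)$ is the minimum $k$ such that there exist $v_1,\dots,v_k\in B$ with the property that for every $u\in B$ there is some $1\le j\le k$ with scalar inner product $v_j\cdot u=0$ (the inner product being $\sum_\ell (v_j)_\ell u_\ell$). -}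

module Defs where

open import Level using (0ℓ)
open import Data.Nat using (ℕ; zero; suc)
open import Data.Fin using (Fin; toℕ)
open Fin
open import Data.Product using (Σ; ∃; _×_)
open import Data.Sum using (_⊎_)
open import Relation.Nullary using (¬_)
open import Relation.Binary.PropositionalEquality using (_≡_)
open import Algebra.Bundles using (CommutativeRing)

module _ (R : CommutativeRing 0ℓ 0ℓ) where
  open CommutativeRing R using (Carrier; _≈_; _+_; _*_; 0#; 1#)

  pow : Carrier → ℕ → Carrier
  pow x zero    = 1#
  pow x (suc k) = x * pow x k

  natR : ℕ → Carrier
  natR zero    = 0#
  natR (suc k) = 1# + natR k

  sumFin : (n : ℕ) → (Fin n → Carrier) → Carrier
  sumFin zero    f = 0#
  sumFin (suc n) f = f zero + sumFin n (λ i → f (suc i))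

  IsIntegralDomain : Set
  IsIntegralDomain = ∀ x y → x * y ≈ 0# → (x ≈ 0#) ⊎ (y ≈ 0#)

  CharZero : Set
  CharZero = ∀ k → natR k ≈ 0# → k ≡ 0

  -- w is a primitive p-th root of unity (p prime, so w ≠ 1 and w^p = 1 suffice)
  IsPrimRootOfUnity : ℕ → Carrier → Set
  IsPrimRootOfUnity p w = pow w p ≈ 1# × ¬ (w ≈ 1#)

  -- A vector of B (coordinates in {1, w, …, w^{p-1}}) is encoded by its
  -- exponent vector a : Fin n → Fin p, meaning coordinate ℓ is w^(a ℓ).
  Bvec : ℕ → ℕ → Set
  Bvec n p = Fin n → Fin p

  -- scalar inner product v · u = Σ_ℓ v_ℓ u_ℓ  (no conjugation)
  inner : (w : Carrier) {n p : ℕ} → Bvec n p → Bvec n p → Carrier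
  inner w {n} v u = sumFin n (λ l → pow w (toℕ (v l)) * pow w (toℕ (u l)))

  IsCovering : (w : Carrier) (n p k : ℕ) → (Fin k → Bvec n p) → Set
  IsCovering w n p k V = ∀ (u : Bvec n p) → ∃ λ (j : Fin k) → inner w (V j) u ≈ 0#

-- Write v · u = Σ_j c_j w^j, where c_j counts the coordinates ℓ with
-- v_ℓ + u_ℓ ≡ j (mod p). As Φ_p(X + 1) is Eisenstein at p, no nonzero integer
-- polynomial of degree < p − 1 vanishes at w − 1 (the least-degree one would,
-- after pseudo-division, divide a multiple of Φ_p(X + 1)); so Σ_j c_j w^j = 0
-- forces c_0 = ⋯ = c_(p−1) = n/p. For fixed v, the number of such u is the
-- multinomial coefficient n! / ((n/p)!)^p; every u is orthogonal to some v_j,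
-- so summing over j covers all p^n words.

module Submission where

open import Defs
open import Level using (0ℓ)
open import Data.Nat as ℕ using (ℕ; zero; suc; _≤_; _<_; _∸_; _≡ᵇ_; z≤n; s≤s)
import Data.Nat.Properties as ℕ
open import Data.Nat.Combinatorics using (nC1≡n; nCn≡1)
import Data.Nat.Divisibility as ℕ∣
open import Data.Nat.Induction using (<-wellFounded)
open import Data.Nat.Primality using (Prime; euclidsLemma; prime⇒nonZero; prime⇒nonTrivial)
open import Data.Integer as ℤ using (ℤ; +_; -[1+_]; _⊖_; 0ℤ; 1ℤ; ∣_∣)
import Data.Integer.Properties as ℤ
open import Data.Integer.Divisibility.Signed as ℤ∣ using (divides) renaming (_∣_ to _∣ℤ_; _∣?_ to _∣ℤ?_)
open import Data.Integer.Tactic.RingSolver using (solve-∀)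
open import Data.Fin as Fin using (Fin; zero; suc; toℕ; fromℕ; inject₁)
import Data.Fin.Properties as Fin
open import Data.Vec.Functional using (Vector; []; _∷_; zipWith)
open import Data.Bool using (Bool; true; false; T; _∧_; _∨_; if_then_else_)
open import Data.Bool.Properties using (∧-zeroʳ)
open import Data.Unit using (tt)
open import Data.Product using (Σ; _,_; proj₁; proj₂)
open import Data.Sum using (_⊎_; inj₁; inj₂)
open import Data.Empty using (⊥; ⊥-elim)
open import Data.Maybe using (Maybe; just; nothing)
open import Function using (_∘_)
open import Induction.WellFounded using (Acc; acc)
open import Relation.Nullary using (¬_; yes; no)
open import Relation.Binary.Definitions using (tri<; tri≈; tri>)
open import Relation.Binary.PropositionalEquality as ≡ using (_≡_; _≢_)
open import Algebra.Bundles using (CommutativeRing)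
import Algebra.Solver.Ring
open import Algebra.Solver.Ring.AlmostCommutativeRing using (fromCommutativeRing; _-Raw-AlmostCommutative⟶_)
open import Algebra.Properties.Semiring.Sum ℕ.+-*-semiring
  using (sum; sum-syntax; sum-cong-≗; sum-init-last; ∑-distrib-+; *-distribʳ-sum)
open import Algebra.Properties.CommutativeSemigroup ℕ.*-commutativeSemigroup using (x∙yz≈y∙xz)

module Polynomials where
  open import Data.Integer using (_+_; _*_; -_)
  open import Data.Nat.Combinatorics using (_C_; nCk+nC[k+1]≡[n+1]C[k+1])
  open ≡ using (refl; sym; trans; cong; cong₂; subst; module ≡-Reasoning)

  Poly : Set
  Poly = ℕ → ℤ

  infix 4 _HasDegree<_
  _HasDegree<_ : Poly → ℕ → Set
  f HasDegree< N = ∀ k → N ≤ k → f k ≡ 0ℤ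

  HasDegree<-suc : ∀ {f N} → f HasDegree< suc N → f N ≡ 0ℤ → f HasDegree< N
  HasDegree<-suc deg fN≡0 k N≤k with ℕ.m≤n⇒m<n∨m≡n N≤k
  ... | inj₁ N<k  = deg k N<k
  ... | inj₂ refl = fN≡0

  infixl 7 _⊛_
  _⊛_ : Poly → Poly → Poly
  (f ⊛ g) zero    = f 0 * g 0
  (f ⊛ g) (suc k) = f 0 * g (suc k) + ((f ∘ suc) ⊛ g) k

  ⊛-congˡ : ∀ {f f′} g → (∀ i → f i ≡ f′ i) → ∀ k → (f ⊛ g) k ≡ (f′ ⊛ g) k
  ⊛-congˡ g f≗f′ zero    = cong (_* g 0) (f≗f′ 0)
  ⊛-congˡ g f≗f′ (suc k) = cong₂ _+_ (cong (_* g (suc k)) (f≗f′ 0)) (⊛-congˡ g (f≗f′ ∘ suc) k)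

  ⊛-distribʳ-+ : ∀ f f′ g k → ((λ i → f i + f′ i) ⊛ g) k ≡ (f ⊛ g) k + (f′ ⊛ g) k
  ⊛-distribʳ-+ f f′ g zero    = ℤ.*-distribʳ-+ (g 0) (f 0) (f′ 0)
  ⊛-distribʳ-+ f f′ g (suc k) =
    trans (cong (_+_ ((f 0 + f′ 0) * g (suc k))) (⊛-distribʳ-+ (f ∘ suc) (f′ ∘ suc) g k))
          (lemma (f 0) (f′ 0) (g (suc k)) ((f ∘ suc ⊛ g) k) ((f′ ∘ suc ⊛ g) k))
    where
    lemma : ∀ x y z u v → (x + y) * z + (u + v) ≡ (x * z + u) + (y * z + v)
    lemma = solve-∀

  *-⊛ : ∀ a f g k → ((λ i → a * f i) ⊛ g) k ≡ a * (f ⊛ g) k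
  *-⊛ a f g zero    = ℤ.*-assoc a (f 0) (g 0)
  *-⊛ a f g (suc k) =
    trans (cong (_+_ (a * f 0 * g (suc k))) (*-⊛ a (f ∘ suc) g k))
          (trans (cong (_+ a * (f ∘ suc ⊛ g) k) (ℤ.*-assoc a (f 0) (g (suc k))))
                 (sym (ℤ.*-distribˡ-+ a (f 0 * g (suc k)) ((f ∘ suc ⊛ g) k))))

  zero-⊛ : ∀ g k → ((λ _ → 0ℤ) ⊛ g) k ≡ 0ℤ
  zero-⊛ g zero    = refl
  zero-⊛ g (suc k) = trans (ℤ.+-identityˡ _) (zero-⊛ g k)

  infix 8 X^_
  X^_ : ℕ → Poly
  (X^ zero)  zero    = 1ℤ
  (X^ zero)  (suc k) = 0ℤ
  (X^ suc s) zero    = 0ℤ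
  (X^ suc s) (suc k) = (X^ s) k

  X^-degree : ∀ s → (X^ s) HasDegree< suc s
  X^-degree zero    (suc k) _         = refl
  X^-degree (suc s) (suc k) (s≤s s<k) = X^-degree s k s<k

  shift : ℕ → Poly → Poly
  shift zero    g         = g
  shift (suc s) g zero    = 0ℤ
  shift (suc s) g (suc k) = shift s g k

  shift-+ : ∀ s g j → shift s g (s ℕ.+ j) ≡ g j
  shift-+ zero    g j = refl
  shift-+ (suc s) g j = shift-+ s g j

  shift-degree : ∀ s {g N} → g HasDegree< N → shift s g HasDegree< (s ℕ.+ N)
  shift-degree zero    deg = deg
  shift-degree (suc s) deg (suc k) (s≤s le) = shift-degree s deg k le

  X^-⊛ : ∀ s g k → (X^ s ⊛ g) k ≡ shift s g k
  X^-⊛ zero    g zero    = ℤ.*-identityˡ (g 0)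
  X^-⊛ zero    g (suc k) = trans (cong (_+_ (1ℤ * g (suc k))) (zero-⊛ g k))
                                 (trans (ℤ.+-identityʳ _) (ℤ.*-identityˡ _))
  X^-⊛ (suc s) g zero    = refl
  X^-⊛ (suc s) g (suc k) = trans (ℤ.+-identityˡ _) (X^-⊛ s g k)

  -- For f of degree < N, translate N f is f(X + 1): it unfolds
  -- f(X + 1) = f 0 + (X + 1) · f′(X + 1) where f = f 0 + X · f′.
  translate : ℕ → Poly → Poly
  translate zero    f k       = 0ℤ
  translate (suc N) f zero    = f 0 + translate N (f ∘ suc) 0
  translate (suc N) f (suc k) = translate N (f ∘ suc) k + translate N (f ∘ suc) (suc k)

  translate-degree : ∀ N f → translate N f HasDegree< N
  translate-degree zero    f k       _         = refl
  translate-degree (suc N) f (suc k) (s≤s N≤k) =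
    cong₂ _+_ (translate-degree N (f ∘ suc) k N≤k)
              (translate-degree N (f ∘ suc) (suc k) (ℕ.m≤n⇒m≤1+n N≤k))

  alternating-vanishes : ∀ {C N} → (∀ k → C k + C (suc k) ≡ 0ℤ) → C HasDegree< N →
                         ∀ j k → N ≤ j ℕ.+ k → C k ≡ 0ℤ
  alternating-vanishes         alt deg zero    k N≤k   = deg k N≤k
  alternating-vanishes {C} {N} alt deg (suc j) k N≤j+k = begin
    C k             ≡⟨ ℤ.+-identityʳ (C k) ⟨
    C k + 0ℤ        ≡⟨ cong (_+_ (C k)) (alternating-vanishes alt deg j (suc k) N≤j+1+k) ⟨
    C k + C (suc k) ≡⟨ alt k ⟩
    0ℤ              ∎
    where
    open ≡-Reasoning
    N≤j+1+k : N ≤ j ℕ.+ suc k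
    N≤j+1+k = subst (N ≤_) (sym (ℕ.+-suc j k)) N≤j+k

  translate-suc-vanishes : ∀ N f → (∀ k → translate (suc N) f k ≡ 0ℤ) → ∀ k → translate N (f ∘ suc) k ≡ 0ℤ
  translate-suc-vanishes N f f⁺≡0 k =
    alternating-vanishes (f⁺≡0 ∘ suc) (translate-degree N (f ∘ suc)) N k (ℕ.m≤m+n N k)

  translate-injective : ∀ N f → (∀ k → translate N f k ≡ 0ℤ) → ∀ k → k < N → f k ≡ 0ℤ
  translate-injective (suc N) f f⁺≡0 zero    _ = begin
    f 0                               ≡⟨ ℤ.+-identityʳ (f 0) ⟨
    f 0 + 0ℤ                          ≡⟨ cong (_+_ (f 0)) (translate-suc-vanishes N f f⁺≡0 0) ⟨
    f 0 + translate N (f ∘ suc) 0     ≡⟨ f⁺≡0 0 ⟩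
    0ℤ                                ∎
    where open ≡-Reasoning
  translate-injective (suc N) f f⁺≡0 (suc k) (s≤s k<N) =
    translate-injective N (f ∘ suc) (translate-suc-vanishes N f f⁺≡0) k k<N

  geometric : ℕ → Poly
  geometric zero    k       = 0ℤ
  geometric (suc N) zero    = 1ℤ
  geometric (suc N) (suc k) = geometric N k

  geometric-degree : ∀ N → geometric N HasDegree< N
  geometric-degree zero    k       _         = refl
  geometric-degree (suc N) (suc k) (s≤s N≤k) = geometric-degree N k N≤k

  geometric-< : ∀ {N k} → k < N → geometric N k ≡ 1ℤ
  geometric-< {suc N} {zero}  _         = refl
  geometric-< {suc N} {suc k} (s≤s k<N) = geometric-< k<N

  translate-geometric : ∀ N k → translate N (geometric N) k ≡ + (N C suc k)
  translate-geometric zero    k       = refl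
  translate-geometric (suc N) zero    =
    trans (cong (_+_ 1ℤ) (translate-geometric N 0))
          (trans (sym (ℤ.pos-+ 1 (N C 1))) (cong +_ (nCk+nC[k+1]≡[n+1]C[k+1] N 0)))
  translate-geometric (suc N) (suc k) =
    trans (cong₂ _+_ (translate-geometric N k) (translate-geometric N (suc k)))
          (trans (sym (ℤ.pos-+ (N C suc k) (N C suc (suc k))))
                 (cong +_ (nCk+nC[k+1]≡[n+1]C[k+1] N (suc k))))

open Polynomials

module Eisenstein where
  open import Data.Integer using (_+_; _*_; -_)
  open import Data.Nat.Combinatorics using (_C_; nCk+nC[k+1]≡[n+1]C[k+1])
  open ≡ using (refl; sym; trans; cong; cong₂; subst; module ≡-Reasoning)
  open import Data.Nat.Divisibility using (_∣_)

  suc-*-C : ∀ n k → suc k ℕ.* (suc n C suc k) ≡ suc n ℕ.* (n C k)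
  suc-*-C zero    zero    = refl
  suc-*-C zero    (suc k) = ℕ.*-zeroʳ (suc (suc k))
  suc-*-C (suc n) zero    =
    trans (ℕ.*-identityˡ _) (trans (nC1≡n (suc (suc n))) (sym (ℕ.*-identityʳ _)))
  suc-*-C (suc n) (suc k) = begin
    suc (suc k) ℕ.* (suc (suc n) C suc (suc k))
      ≡⟨ cong (suc (suc k) ℕ.*_) (sym (nCk+nC[k+1]≡[n+1]C[k+1] (suc n) (suc k))) ⟩
    suc (suc k) ℕ.* (a ℕ.+ b)
      ≡⟨ ℕ.*-distribˡ-+ (suc (suc k)) a b ⟩
    a ℕ.+ suc k ℕ.* a ℕ.+ suc (suc k) ℕ.* b
      ≡⟨ cong₂ (λ x y → a ℕ.+ x ℕ.+ y) (suc-*-C n k) (suc-*-C n (suc k)) ⟩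
    a ℕ.+ suc n ℕ.* (n C k) ℕ.+ suc n ℕ.* (n C suc k)
      ≡⟨ ℕ.+-assoc a _ _ ⟩
    a ℕ.+ (suc n ℕ.* (n C k) ℕ.+ suc n ℕ.* (n C suc k))
      ≡⟨ cong (a ℕ.+_) (sym (ℕ.*-distribˡ-+ (suc n) (n C k) (n C suc k))) ⟩
    a ℕ.+ suc n ℕ.* (n C k ℕ.+ n C suc k)
      ≡⟨ cong (λ x → a ℕ.+ suc n ℕ.* x) (nCk+nC[k+1]≡[n+1]C[k+1] n k) ⟩
    suc (suc n) ℕ.* a ∎
    where
    open ≡-Reasoning
    a = suc n C suc k
    b = suc n C suc (suc k)

  prime∣C : ∀ {n k} → Prime (suc n) → 0 < k → k < suc n → suc n ∣ (suc n C k)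
  prime∣C {n} {suc k} pr _ (s≤s k<n)
    with euclidsLemma (suc k) (suc n C suc k) pr (subst (suc n ∣_) (sym (suc-*-C n k)) (ℕ∣.m∣m*n (n C k)))
  ... | inj₂ p∣C   = p∣C
  ... | inj₁ p∣1+k = ⊥-elim (ℕ.<-irrefl refl (ℕ.<-≤-trans (s≤s k<n) (ℕ∣.∣⇒≤ p∣1+k)))

  left-positive : ∀ {t s d m} → t ℕ.+ s ≡ m → s ≤ d → d < m → 0 < t
  left-positive {suc t} _    _   _   = s≤s z≤n
  left-positive {zero}  refl s≤d d<m = ⊥-elim (ℕ.<-irrefl refl (ℕ.≤-<-trans s≤d d<m))

  right-positive : ∀ {t s d m} → t ℕ.+ s ≡ m → t ℕ.+ d ≤ m → 1 ≤ d → 0 < s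
  right-positive {t} {suc s} _ _ _ = s≤s z≤n
  right-positive {t} {zero} {d} refl t+d≤t+0 1≤d =
    ⊥-elim (ℕ.<-irrefl refl (ℕ.<-≤-trans (ℕ.+-monoʳ-< t 1≤d) t+d≤t+0))

  module Divisibility (p : ℕ) (p-prime : Prime p) where

    instance
      p≢0 : ℕ.NonZero p
      p≢0 = prime⇒nonZero p-prime

    p>1 : 1 < p
    p>1 = ℕ.nonTrivial⇒n>1 p {{prime⇒nonTrivial p-prime}}

    P : ℤ
    P = + p

    euclid : ∀ a b → P ∣ℤ a * b → P ∣ℤ a ⊎ P ∣ℤ b
    euclid a b p∣ab with euclidsLemma ∣ a ∣ ∣ b ∣ p-prime (subst (p ∣_) (ℤ.abs-* a b) (ℤ∣.∣⇒∣ᵤ p∣ab))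
    ... | inj₁ p∣a = inj₁ (ℤ∣.∣ᵤ⇒∣ p∣a)
    ... | inj₂ p∣b = inj₂ (ℤ∣.∣ᵤ⇒∣ p∣b)

    ∤-* : ∀ {a b} → ¬ P ∣ℤ a → ¬ P ∣ℤ b → ¬ P ∣ℤ a * b
    ∤-* {a} {b} p∤a p∤b p∣ab with euclid a b p∣ab
    ... | inj₁ p∣a = p∤a p∣a
    ... | inj₂ p∣b = p∤b p∣b

    p∣0 : P ∣ℤ 0ℤ
    p∣0 = divides 0ℤ refl

    _/p : ∀ {z} → P ∣ℤ z → ℤ
    _/p = ℤ∣.quotient

    /p-* : ∀ {z} (p∣z : P ∣ℤ z) → z ≡ (p∣z /p) * P
    /p-* = ℤ∣._∣_.equality

    /p≢0 : ∀ {z} (p∣z : P ∣ℤ z) → z ≢ 0ℤ → p∣z /p ≢ 0ℤ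
    /p≢0 p∣z z≢0 z/p≡0 = z≢0 (trans (/p-* p∣z) (cong (_* P) z/p≡0))

    ∣/p∣<∣∣ : ∀ {z} (p∣z : P ∣ℤ z) → z ≢ 0ℤ → ∣ p∣z /p ∣ < ∣ z ∣
    ∣/p∣<∣∣ p∣z z≢0 = subst (∣ p∣z /p ∣ <_) (sym (trans (cong ∣_∣ (/p-* p∣z)) (ℤ.abs-* (p∣z /p) P)))
                        (ℕ.m<m*n _ p {{ℕ.≢-nonZero (/p≢0 p∣z z≢0 ∘ ℤ.∣i∣≡0⇒i≡0)}} p>1)

    _/pᶜ : ∀ {f : Poly} → (∀ k → P ∣ℤ f k) → Poly
    (p∣f /pᶜ) k = p∣f k /p

    /pᶜ-degree : ∀ {f N} (p∣f : ∀ k → P ∣ℤ f k) → f HasDegree< N → (p∣f /pᶜ) HasDegree< N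
    /pᶜ-degree p∣f f-degree k N≤k
      with ℤ.i*j≡0⇒i≡0∨j≡0 ((p∣f /pᶜ) k) (trans (sym (/p-* (p∣f k))) (f-degree k N≤k))
    ... | inj₁ f/p≡0 = f/p≡0
    ... | inj₂ P≡0   = ⊥-elim (ℕ.≢-nonZero⁻¹ p (ℤ.+-injective P≡0))

    DivisibleBelow : Poly → ℕ → Set
    DivisibleBelow f t = ∀ j → j < t → P ∣ℤ f j

    record LowestNonDivisible (f : Poly) (s : ℕ) : Set where
      field
        below : DivisibleBelow f s
        at    : ¬ P ∣ℤ f s

    lowestNonDivisible : ∀ f {i} → ¬ P ∣ℤ f i → Σ ℕ (LowestNonDivisible f)
    lowestNonDivisible f {i} p∤fi with P ∣ℤ? f 0
    lowestNonDivisible f {i}     p∤fi | no p∤f0 = 0 , record { below = λ _ () ; at = p∤f0 }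
    lowestNonDivisible f {zero}  p∤fi | yes p∣f0 = ⊥-elim (p∤fi p∣f0)
    lowestNonDivisible f {suc i} p∤fi | yes p∣f0 with lowestNonDivisible (f ∘ suc) p∤fi
    ... | s , lowest = suc s , record { below = below′ ; at = at }
      where
      open LowestNonDivisible lowest
      below′ : DivisibleBelow f (suc s)
      below′ zero    _         = p∣f0
      below′ (suc j) (s≤s j<s) = below j j<s

    divisible-or-witness : ∀ {f} N → f HasDegree< N → (∀ k → P ∣ℤ f k) ⊎ Σ ℕ (λ i → ¬ P ∣ℤ f i)
    divisible-or-witness {f} zero deg = inj₁ λ k → subst (P ∣ℤ_) (sym (deg k z≤n)) p∣0
    divisible-or-witness {f} (suc N) deg with P ∣ℤ? f 0
    ... | no p∤f0 = inj₂ (0 , p∤f0)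
    ... | yes p∣f0 with divisible-or-witness {f ∘ suc} N (λ k N≤k → deg (suc k) (s≤s N≤k))
    ...   | inj₂ (i , p∤fi) = inj₂ (suc i , p∤fi)
    ...   | inj₁ p∣f        = inj₁ λ { zero → p∣f0 ; (suc k) → p∣f k }

    nonDivisible-< : ∀ {f N k} → f HasDegree< N → ¬ P ∣ℤ f k → k < N
    nonDivisible-< {f} {N} {k} deg p∤fk with ℕ.<-cmp k N
    ... | tri< k<N _ _ = k<N
    ... | tri≈ _ refl _ = ⊥-elim (p∤fk (subst (P ∣ℤ_) (sym (deg k ℕ.≤-refl)) p∣0))
    ... | tri> _ _ k>N  = ⊥-elim (p∤fk (subst (P ∣ℤ_) (sym (deg k (ℕ.<⇒≤ k>N))) p∣0))

    ∣-⊛ˡ : ∀ {f} g → (∀ i → P ∣ℤ f i) → ∀ k → P ∣ℤ (f ⊛ g) k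
    ∣-⊛ˡ {f} g p∣f zero    = ℤ∣.∣m⇒∣m*n (g 0) (p∣f 0)
    ∣-⊛ˡ {f} g p∣f (suc k) = ℤ∣.∣m∣n⇒∣m+n (ℤ∣.∣m⇒∣m*n (g (suc k)) (p∣f 0)) (∣-⊛ˡ g (p∣f ∘ suc) k)

    ∣-⊛ʳ-below : ∀ f {g t} → DivisibleBelow g t → DivisibleBelow (f ⊛ g) t
    ∣-⊛ʳ-below f p∣g zero    0<t = ℤ∣.∣n⇒∣m*n (f 0) (p∣g 0 0<t)
    ∣-⊛ʳ-below f p∣g (suc k) k<t =
      ℤ∣.∣m∣n⇒∣m+n (ℤ∣.∣n⇒∣m*n (f 0) (p∣g (suc k) k<t))
                   (∣-⊛ʳ-below (f ∘ suc) p∣g k (ℕ.<-trans (ℕ.n<1+n k) k<t))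

    -- ℤ/p[X] is an integral domain.
    ⊛-lowestNonDivisible : ∀ {f g s t} → LowestNonDivisible f s → LowestNonDivisible g t →
                           LowestNonDivisible (f ⊛ g) (s ℕ.+ t)
    ⊛-lowestNonDivisible {f} {g} {zero} {t} fₛ gₜ = record
      { below = ∣-⊛ʳ-below f (LowestNonDivisible.below gₜ) ; at = at t refl }
      where
      at : ∀ k → k ≡ t → ¬ P ∣ℤ (f ⊛ g) k
      at zero    refl = ∤-* (LowestNonDivisible.at fₛ) (LowestNonDivisible.at gₜ)
      at (suc k) refl p∣ =
        ∤-* (LowestNonDivisible.at fₛ) (LowestNonDivisible.at gₜ)
            (ℤ∣.∣m+n∣n⇒∣m p∣ (∣-⊛ʳ-below (f ∘ suc) (LowestNonDivisible.below gₜ) k (ℕ.n<1+n k)))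
    ⊛-lowestNonDivisible {f} {g} {suc s} {t} fₛ gₜ = record { below = below ; at = at }
      where
      p∣f0 : P ∣ℤ f 0
      p∣f0 = LowestNonDivisible.below fₛ 0 (s≤s z≤n)
      tail = ⊛-lowestNonDivisible {f ∘ suc} {g} {s} {t}
               (record { below = λ j j<s → LowestNonDivisible.below fₛ (suc j) (s≤s j<s)
                       ; at = LowestNonDivisible.at fₛ }) gₜ
      below : DivisibleBelow (f ⊛ g) (suc s ℕ.+ t)
      below zero    _         = ℤ∣.∣m⇒∣m*n (g 0) p∣f0
      below (suc k) (s≤s k<n) =
        ℤ∣.∣m∣n⇒∣m+n (ℤ∣.∣m⇒∣m*n (g (suc k)) p∣f0) (LowestNonDivisible.below tail k k<n)
      at : ¬ P ∣ℤ (f ⊛ g) (suc s ℕ.+ t)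
      at p∣ = LowestNonDivisible.at tail (ℤ∣.∣m+n∣m⇒∣n p∣ (ℤ∣.∣m⇒∣m*n (g (suc (s ℕ.+ t))) p∣f0))

    record IsEisenstein (m : ℕ) (Ψ : Poly) : Set where
      field
        constant : Ψ 0 ≡ P
        middle   : DivisibleBelow Ψ m
        leading  : ¬ P ∣ℤ Ψ m
        degree   : Ψ HasDegree< suc m

    NonzeroModP : Poly → Set
    NonzeroModP f = Σ ℕ λ i → ¬ P ∣ℤ f i

    module _ {m Ψ} (eisenstein : IsEisenstein m Ψ) where
      open IsEisenstein eisenstein

      nonDivisible-multiple⇒top : ∀ c {k} → ¬ P ∣ℤ c * Ψ k → k ≡ m
      nonDivisible-multiple⇒top c {k} p∤cΨ with ℕ.<-cmp k m
      ... | tri< k<m _ _ = ⊥-elim (p∤cΨ (ℤ∣.∣n⇒∣m*n c (middle k k<m)))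
      ... | tri≈ _ k≡m _ = k≡m
      ... | tri> _ _ k>m = ⊥-elim (p∤cΨ (subst (P ∣ℤ_) (sym (trans (cong (c *_) (degree k k>m)) (ℤ.*-zeroʳ c))) p∣0))

      -- If p ∤ c, the lowest non-divisible coefficients of Q and G must be their
      -- leading ones, so p divides both constant terms and p² ∣ c Ψ 0 = c p.
      irreducible-coprime : ∀ {c d} Q G → ¬ P ∣ℤ c → 1 ≤ d → d < m →
                            G HasDegree< suc d → Q HasDegree< (suc m ∸ d) → NonzeroModP G →
                            (∀ k → (Q ⊛ G) k ≡ c * Ψ k) → ⊥
      irreducible-coprime {c} {d} Q G p∤c 1≤d d<m degG degQ (i , p∤Gi) QG≡cΨ
        with divisible-or-witness (suc m ∸ d) degQ
      ... | inj₁ p∣Q with euclid c (Ψ m) (subst (P ∣ℤ_) (QG≡cΨ m) (∣-⊛ˡ G p∣Q m))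
      ...   | inj₁ p∣c  = p∤c p∣c
      ...   | inj₂ p∣Ψm = leading p∣Ψm
      irreducible-coprime {c} {d} Q G p∤c 1≤d d<m degG degQ (i , p∤Gi) QG≡cΨ
          | inj₂ (j , p∤Qj) with lowestNonDivisible Q p∤Qj | lowestNonDivisible G p∤Gi
      ... | t , Qₜ | s , Gₛ = p∤c (ℤ∣.*-cancelˡ-∣ P p²∣pc)
        where
        t+s≡m : t ℕ.+ s ≡ m
        t+s≡m = nonDivisible-multiple⇒top c
                  (subst (λ z → ¬ P ∣ℤ z) (QG≡cΨ (t ℕ.+ s)) (LowestNonDivisible.at (⊛-lowestNonDivisible Qₜ Gₛ)))
        s≤d : s ℕ.≤ d
        s≤d = ℕ.≤-pred (nonDivisible-< degG (LowestNonDivisible.at Gₛ))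
        t+d≤m : t ℕ.+ d ℕ.≤ m
        t+d≤m = ℕ.≤-pred (ℕ.m≤o∸n⇒m+n≤o (suc t) (ℕ.<⇒≤ (ℕ.m<n⇒m<1+n d<m))
                                         (nonDivisible-< degQ (LowestNonDivisible.at Qₜ)))
        p²∣pc : P * P ∣ℤ P * c
        p²∣pc = divides (a * b) (begin
          P * c                 ≡⟨ ℤ.*-comm P c ⟩
          c * P                 ≡⟨ cong (c *_) constant ⟨
          c * Ψ 0               ≡⟨ QG≡cΨ 0 ⟨
          Q 0 * G 0             ≡⟨ cong₂ _*_ (/p-* p∣Q0) (/p-* p∣G0) ⟩
          (a * P) * (b * P)     ≡⟨ lemma a b P ⟩
          (a * b) * (P * P)     ∎)
          where
          open ≡-Reasoning
          p∣Q0 = LowestNonDivisible.below Qₜ 0 (left-positive t+s≡m s≤d d<m)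
          p∣G0 = LowestNonDivisible.below Gₛ 0 (right-positive t+s≡m t+d≤m 1≤d)
          a = p∣Q0 /p
          b = p∣G0 /p
          lemma : ∀ a b c → (a * c) * (b * c) ≡ (a * b) * (c * c)
          lemma = solve-∀

      -- Dividing c and Q by p while p ∣ c (when p ∣ c the product Q G is
      -- divisible, and G is not, so Q is) reduces to the coprime case.
      irreducible : ∀ {c d} Q G → c ≢ 0ℤ → 1 ≤ d → d < m →
                    G HasDegree< suc d → Q HasDegree< (suc m ∸ d) → NonzeroModP G →
                    (∀ k → (Q ⊛ G) k ≡ c * Ψ k) → ⊥
      irreducible {c} Q G c≢0 = go c (<-wellFounded ∣ c ∣) Q c≢0
        where
        go : ∀ {d} c → Acc _<_ ∣ c ∣ → ∀ Q → c ≢ 0ℤ → 1 ≤ d → d < m →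
             G HasDegree< suc d → Q HasDegree< (suc m ∸ d) → NonzeroModP G →
             (∀ k → (Q ⊛ G) k ≡ c * Ψ k) → ⊥
        go {d} c (acc rec) Q c≢0 1≤d d<m degG degQ (i , p∤Gi) QG≡cΨ
          with P ∣ℤ? c
        ... | no p∤c = irreducible-coprime Q G p∤c 1≤d d<m degG degQ (i , p∤Gi) QG≡cΨ
        ... | yes p∣c with divisible-or-witness (suc m ∸ d) degQ
        ...   | inj₂ (j , p∤Qj) with lowestNonDivisible Q p∤Qj | lowestNonDivisible G p∤Gi
        ...     | t , Qₜ | s , Gₛ = LowestNonDivisible.at (⊛-lowestNonDivisible Qₜ Gₛ)
                    (subst (P ∣ℤ_) (sym (QG≡cΨ (t ℕ.+ s))) (ℤ∣.∣m⇒∣m*n (Ψ (t ℕ.+ s)) p∣c))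
        go {d} c (acc rec) Q c≢0 1≤d d<m degG degQ (i , p∤Gi) QG≡cΨ | yes p∣c | inj₁ p∣Q =
          go c′ (rec (∣/p∣<∣∣ p∣c c≢0)) Q′ (/p≢0 p∣c c≢0) 1≤d d<m degG (/pᶜ-degree p∣Q degQ)
             (i , p∤Gi) Q′G≡c′Ψ
          where
          c′ = p∣c /p
          Q′ = p∣Q /pᶜ
          Q′G≡c′Ψ : ∀ k → (Q′ ⊛ G) k ≡ c′ * Ψ k
          Q′G≡c′Ψ k = ℤ.*-cancelˡ-≡ P _ _ (begin
            P * (Q′ ⊛ G) k                     ≡⟨ *-⊛ P Q′ G k ⟨
            ((λ j → P * Q′ j) ⊛ G) k
              ≡⟨ ⊛-congˡ G (λ j → trans (ℤ.*-comm P (Q′ j)) (sym (/p-* (p∣Q j)))) k ⟩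
            (Q ⊛ G) k                          ≡⟨ QG≡cΨ k ⟩
            c * Ψ k                            ≡⟨ cong (_* Ψ k) (/p-* p∣c) ⟩
            c′ * P * Ψ k                       ≡⟨ lemma c′ P (Ψ k) ⟩
            P * (c′ * Ψ k)                     ∎)
            where
            open ≡-Reasoning
            lemma : ∀ a b c → a * b * c ≡ b * (a * c)
            lemma = solve-∀

open Eisenstein

module Evaluation (R : CommutativeRing 0ℓ 0ℓ) where
  open CommutativeRing R
  open import Algebra.Properties.Ring ring using (-0#≈0#; -‿involutive; -‿+-comm; -‿distribˡ-*; -‿distribʳ-*)
  open import Algebra.Properties.Semiring.Mult semiring using (×-homo-+; ×1-homo-*) renaming (_×_ to _·_)
  open import Relation.Binary.Reasoning.Setoid setoid

  natR≈·1# : ∀ n → natR R n ≈ n · 1#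
  natR≈·1# zero    = refl
  natR≈·1# (suc n) = +-congˡ (natR≈·1# n)

  fromℤ : ℤ → Carrier
  fromℤ (+ n)     = n · 1#
  fromℤ -[1+ n ] = - (suc n · 1#)

  fromℤ-neg : ∀ i → fromℤ (ℤ.- i) ≈ - fromℤ i
  fromℤ-neg (+ zero)  = sym -0#≈0#
  fromℤ-neg (+ suc n) = refl
  fromℤ-neg -[1+ n ] = sym (-‿involutive _)

  fromℤ-⊖ : ∀ m n → fromℤ (m ⊖ n) ≈ m · 1# - n · 1#
  fromℤ-⊖ zero    zero    = sym (-‿inverseʳ 0#)
  fromℤ-⊖ (suc m) zero    = sym (trans (+-congˡ -0#≈0#) (+-identityʳ _))
  fromℤ-⊖ zero    (suc n) = sym (+-identityˡ _)
  fromℤ-⊖ (suc m) (suc n) = begin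
    fromℤ (suc m ⊖ suc n)  ≡⟨ ≡.cong fromℤ (ℤ.[1+m]⊖[1+n]≡m⊖n m n) ⟩
    fromℤ (m ⊖ n)          ≈⟨ fromℤ-⊖ m n ⟩
    m · 1# - n · 1#        ≈⟨ cancel-1# (m · 1#) (n · 1#) ⟩
    (1# + m · 1#) - (1# + n · 1#) ∎
    where
    cancel-1# : ∀ a b → a - b ≈ (1# + a) - (1# + b)
    cancel-1# a b = begin
      a - b                  ≈⟨ +-identityˡ _ ⟨
      0# + (a - b)           ≈⟨ +-congʳ (-‿inverseʳ 1#) ⟨
      (1# - 1#) + (a - b)    ≈⟨ +-assoc _ _ _ ⟩
      1# + (- 1# + (a - b))  ≈⟨ +-congˡ (+-assoc _ _ _) ⟨
      1# + ((- 1# + a) - b)  ≈⟨ +-congˡ (+-congʳ (+-comm _ _)) ⟩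
      1# + ((a - 1#) - b)    ≈⟨ +-congˡ (+-assoc _ _ _) ⟩
      1# + (a + (- 1# - b))  ≈⟨ +-congˡ (+-congˡ (-‿+-comm 1# b)) ⟩
      1# + (a - (1# + b))    ≈⟨ +-assoc _ _ _ ⟨
      (1# + a) - (1# + b)    ∎

  fromℤ-+ : ∀ i j → fromℤ (i ℤ.+ j) ≈ fromℤ i + fromℤ j
  fromℤ-+ (+ m)     (+ n)     = ×-homo-+ 1# m n
  fromℤ-+ (+ m)     -[1+ n ] = fromℤ-⊖ m (suc n)
  fromℤ-+ -[1+ m ] (+ n)     = trans (fromℤ-⊖ n (suc m)) (+-comm _ _)
  fromℤ-+ -[1+ m ] -[1+ n ] = begin
    - (suc (suc (m ℕ.+ n)) · 1#)       ≡⟨ ≡.cong (λ t → - (suc t · 1#)) (≡.sym (ℕ.+-suc m n)) ⟩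
    - ((suc m ℕ.+ suc n) · 1#)         ≈⟨ -‿cong (×-homo-+ 1# (suc m) (suc n)) ⟩
    - (suc m · 1# + suc n · 1#)        ≈⟨ -‿+-comm _ _ ⟨
    - (suc m · 1#) - (suc n · 1#)      ∎

  fromℤ-*-pos : ∀ m j → fromℤ (+ m ℤ.* j) ≈ m · 1# * fromℤ j
  fromℤ-*-pos m (+ n)     = trans (reflexive (≡.cong fromℤ (≡.sym (ℤ.pos-* m n)))) (×1-homo-* m n)
  fromℤ-*-pos m -[1+ n ] = begin
    fromℤ (+ m ℤ.* -[1+ n ])         ≡⟨ ≡.cong fromℤ (≡.sym (ℤ.neg-distribʳ-* (+ m) (+ suc n))) ⟩
    fromℤ (ℤ.- (+ m ℤ.* + suc n))    ≈⟨ fromℤ-neg (+ m ℤ.* + suc n) ⟩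
    - fromℤ (+ m ℤ.* + suc n)        ≈⟨ -‿cong (fromℤ-*-pos m (+ suc n)) ⟩
    - (m · 1# * (suc n · 1#))        ≈⟨ -‿distribʳ-* _ _ ⟩
    m · 1# * fromℤ -[1+ n ]         ∎

  fromℤ-* : ∀ i j → fromℤ (i ℤ.* j) ≈ fromℤ i * fromℤ j
  fromℤ-* (+ m)     j = fromℤ-*-pos m j
  fromℤ-* -[1+ m ] j = begin
    fromℤ (-[1+ m ] ℤ.* j)           ≡⟨ ≡.cong fromℤ (≡.sym (ℤ.neg-distribˡ-* (+ suc m) j)) ⟩
    fromℤ (ℤ.- (+ suc m ℤ.* j))      ≈⟨ fromℤ-neg (+ suc m ℤ.* j) ⟩
    - fromℤ (+ suc m ℤ.* j)          ≈⟨ -‿cong (fromℤ-*-pos (suc m) j) ⟩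
    - (suc m · 1# * fromℤ j)         ≈⟨ -‿distribˡ-* _ _ ⟩
    fromℤ -[1+ m ] * fromℤ j        ∎

  fromℤ-1 : fromℤ 1ℤ ≈ 1#
  fromℤ-1 = +-identityʳ 1#

  fromℤ-homomorphism : CommutativeRing.rawRing ℤ.+-*-commutativeRing -Raw-AlmostCommutative⟶ fromCommutativeRing R
  fromℤ-homomorphism = record
    { ⟦_⟧ = fromℤ ; +-homo = fromℤ-+ ; *-homo = fromℤ-* ; -‿homo = fromℤ-neg
    ; 0-homo = refl ; 1-homo = fromℤ-1 }

  coefficient≟ : ∀ i j → Maybe (fromℤ i ≈ fromℤ j)
  coefficient≟ i j with i ℤ.≟ j
  ... | yes ≡.refl = just refl
  ... | no _       = nothing

  module RingSolver = Algebra.Solver.Ring (CommutativeRing.rawRing ℤ.+-*-commutativeRing)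
                                          (fromCommutativeRing R) fromℤ-homomorphism coefficient≟
  open RingSolver using (solve; _:+_; _:*_; :-_; _:-_; _:=_; con)

  eval : Carrier → ℕ → Poly → Carrier
  eval y zero    f = 0#
  eval y (suc N) f = fromℤ (f 0) + y * eval y N (f ∘ suc)

  eval-cong : ∀ {y} N {f g} → (∀ k → f k ≡ g k) → eval y N f ≈ eval y N g
  eval-cong zero    f≗g = refl
  eval-cong (suc N) f≗g = +-cong (reflexive (≡.cong fromℤ (f≗g 0))) (*-congˡ (eval-cong N (f≗g ∘ suc)))

  eval-congˡ : ∀ {y y′} N f → y ≈ y′ → eval y N f ≈ eval y′ N f
  eval-congˡ zero    f y≈y′ = refl
  eval-congˡ (suc N) f y≈y′ = +-congˡ (*-cong y≈y′ (eval-congˡ N (f ∘ suc) y≈y′))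

  eval-+ : ∀ y N f g → eval y N (λ k → f k ℤ.+ g k) ≈ eval y N f + eval y N g
  eval-+ y zero    f g = sym (+-identityʳ 0#)
  eval-+ y (suc N) f g = begin
    fromℤ (f 0 ℤ.+ g 0) + y * eval y N (λ k → f (suc k) ℤ.+ g (suc k))
      ≈⟨ +-cong (fromℤ-+ (f 0) (g 0)) (*-congˡ (eval-+ y N (f ∘ suc) (g ∘ suc))) ⟩
    (fromℤ (f 0) + fromℤ (g 0)) + y * (eval y N (f ∘ suc) + eval y N (g ∘ suc))
      ≈⟨ solve 5 (λ a b y e e′ → (a :+ b) :+ y :* (e :+ e′) := (a :+ y :* e) :+ (b :+ y :* e′)) refl
           (fromℤ (f 0)) (fromℤ (g 0)) y (eval y N (f ∘ suc)) (eval y N (g ∘ suc)) ⟩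
    eval y (suc N) f + eval y (suc N) g ∎

  eval-* : ∀ y N a f → eval y N (λ k → a ℤ.* f k) ≈ fromℤ a * eval y N f
  eval-* y zero    a f = sym (zeroʳ _)
  eval-* y (suc N) a f = begin
    fromℤ (a ℤ.* f 0) + y * eval y N (λ k → a ℤ.* f (suc k))
      ≈⟨ +-cong (fromℤ-* a (f 0)) (*-congˡ (eval-* y N a (f ∘ suc))) ⟩
    fromℤ a * fromℤ (f 0) + y * (fromℤ a * eval y N (f ∘ suc))
      ≈⟨ solve 4 (λ a b y e → a :* b :+ y :* (a :* e) := a :* (b :+ y :* e)) refl
           (fromℤ a) (fromℤ (f 0)) y (eval y N (f ∘ suc)) ⟩
    fromℤ a * eval y (suc N) f ∎

  eval-+-root : ∀ {y} N {f g} → eval y N f ≈ 0# → eval y N g ≈ 0# → eval y N (λ k → f k ℤ.+ g k) ≈ 0#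
  eval-+-root {y} N {f} {g} f-root g-root =
    trans (eval-+ y N f g) (trans (+-cong f-root g-root) (+-identityʳ 0#))

  eval-*-root : ∀ {y} N a {f} → eval y N f ≈ 0# → eval y N (λ k → a ℤ.* f k) ≈ 0#
  eval-*-root {y} N a {f} f-root = trans (eval-* y N a f) (trans (*-congˡ f-root) (zeroʳ _))

  eval-zero : ∀ {y} N {f} → (∀ k → f k ≡ 0ℤ) → eval y N f ≈ 0#
  eval-zero zero    f≡0 = refl
  eval-zero (suc N) f≡0 =
    trans (+-cong (reflexive (≡.cong fromℤ (f≡0 0))) (*-congˡ (eval-zero N (f≡0 ∘ suc))))
          (trans (+-identityˡ _) (zeroʳ _))

  eval-extend : ∀ {y} N {M f} → f HasDegree< N → N ≤ M → eval y M f ≈ eval y N f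
  eval-extend zero    {M} deg _          = eval-zero M (λ k → deg k z≤n)
  eval-extend (suc N) deg (s≤s N≤M) = +-congˡ (*-congˡ (eval-extend N (λ k N≤k → deg (suc k) (s≤s N≤k)) N≤M))

  eval-shift : ∀ y s N f → eval y (s ℕ.+ N) (shift s f) ≈ pow R y s * eval y N f
  eval-shift y zero    N f = sym (*-identityˡ _)
  eval-shift y (suc s) N f = trans (+-identityˡ _) (trans (*-congˡ (eval-shift y s N f)) (sym (*-assoc _ _ _)))

  eval-translate : ∀ x N f → eval x N (translate N f) ≈ eval (x + 1#) N f
  eval-translate x zero    f = refl
  eval-translate x (suc N) f = begin
    fromℤ (f 0 ℤ.+ C 0) + x * eval x N (λ k → C k ℤ.+ C (suc k))
      ≈⟨ +-cong (fromℤ-+ (f 0) (C 0)) (*-congˡ (eval-+ x N C (C ∘ suc))) ⟩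
    (fromℤ (f 0) + fromℤ (C 0)) + x * (eval x N C + eval x N (C ∘ suc))
      ≈⟨ solve 5 (λ F C₀ X E E′ → (F :+ C₀) :+ X :* (E :+ E′) := F :+ (X :+ con 1ℤ) :* E :+ (C₀ :+ X :* E′ :- E))
           refl (fromℤ (f 0)) (fromℤ (C 0)) x (eval x N C) (eval x N (C ∘ suc)) ⟩
    fromℤ (f 0) + (x + fromℤ 1ℤ) * eval x N C + (fromℤ (C 0) + x * eval x N (C ∘ suc) - eval x N C)
      ≈⟨ +-cong (+-congˡ (*-cong (+-congˡ fromℤ-1) (eval-translate x N (f ∘ suc)))) C-telescopes ⟩
    fromℤ (f 0) + (x + 1#) * eval (x + 1#) N (f ∘ suc) + 0#
      ≈⟨ +-identityʳ _ ⟩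
    fromℤ (f 0) + (x + 1#) * eval (x + 1#) N (f ∘ suc) ∎
    where
    C = translate N (f ∘ suc)
    C-telescopes : fromℤ (C 0) + x * eval x N (C ∘ suc) - eval x N C ≈ 0#
    C-telescopes = trans (+-congʳ (eval-extend N (translate-degree N (f ∘ suc)) (ℕ.n≤1+n N))) (-‿inverseʳ _)

  eval-geometric : ∀ y N → (y - 1#) * eval y N (geometric N) ≈ pow R y N - 1#
  eval-geometric y zero    = trans (zeroʳ _) (sym (-‿inverseʳ 1#))
  eval-geometric y (suc N) = begin
    (y - 1#) * (u + y * E)           ≈⟨ *-congʳ (+-congˡ (-‿cong (sym fromℤ-1))) ⟩
    (y - u) * (u + y * E)
      ≈⟨ solve 2 (λ y e → (y :- con 1ℤ) :* (con 1ℤ :+ y :* e) := y :* ((y :- con 1ℤ) :* e) :+ y :- con 1ℤ) refl y E ⟩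
    y * ((y - u) * E) + y - u        ≈⟨ +-congʳ (+-congʳ (*-congˡ IH)) ⟩
    y * (pow R y N - u) + y - u
      ≈⟨ solve 2 (λ y q → y :* (q :- con 1ℤ) :+ y :- con 1ℤ := y :* q :- con 1ℤ) refl y (pow R y N) ⟩
    y * pow R y N - u                ≈⟨ +-congˡ (-‿cong fromℤ-1) ⟩
    y * pow R y N - 1#               ∎
    where
    u = fromℤ 1ℤ
    E = eval y N (geometric N)
    IH : (y - u) * E ≈ pow R y N - u
    IH = trans (*-congʳ (+-congˡ (-‿cong fromℤ-1)))
               (trans (eval-geometric y N) (+-congˡ (-‿cong (sym fromℤ-1))))

  module PseudoDivision {x : Carrier} {d : ℕ} {G : Poly}
         (G-degree : G HasDegree< suc d) (G-root : eval x (suc d) G ≈ 0#) (Gd≢0 : G d ≢ 0ℤ) where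

    record _PseudoDivides_ (s : ℕ) (H : Poly) : Set where
      field
        scale            : ℤ
        scale≢0          : scale ≢ 0ℤ
        quotient         : Poly
        remainder        : Poly
        quotient-degree  : quotient HasDegree< s
        remainder-degree : remainder HasDegree< d
        remainder-root   : eval x d remainder ≈ 0#
        division         : ∀ k → scale ℤ.* H k ≡ (quotient ⊛ G) k ℤ.+ remainder k

    -- kills the coefficient of X^(s + d) in H
    reduce : ℕ → Poly → Poly
    reduce s H k = G d ℤ.* H k ℤ.+ ℤ.- H (s ℕ.+ d) ℤ.* shift s G k

    reduce-degree : ∀ s {H} → H HasDegree< suc s ℕ.+ d → reduce s H HasDegree< s ℕ.+ d
    reduce-degree s {H} H-degree = HasDegree<-suc below top
      where
      g = G d
      h = H (s ℕ.+ d)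
      shift-G-degree : shift s G HasDegree< suc (s ℕ.+ d)
      shift-G-degree = ≡.subst (shift s G HasDegree<_) (ℕ.+-suc s d) (shift-degree s G-degree)
      below : reduce s H HasDegree< suc (s ℕ.+ d)
      below k le = ≡.cong₂ ℤ._+_ (≡.trans (≡.cong (g ℤ.*_) (H-degree k le)) (ℤ.*-zeroʳ g))
                                 (≡.trans (≡.cong (ℤ.- h ℤ.*_) (shift-G-degree k le)) (ℤ.*-zeroʳ (ℤ.- h)))
      cancel : ∀ g h → g ℤ.* h ℤ.+ ℤ.- h ℤ.* g ≡ 0ℤ
      cancel = solve-∀
      top : reduce s H (s ℕ.+ d) ≡ 0ℤ
      top = ≡.trans (≡.cong (λ t → g ℤ.* h ℤ.+ ℤ.- h ℤ.* t) (shift-+ s G d)) (cancel g h)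

    reduce-root : ∀ s {H} → H HasDegree< suc s ℕ.+ d → eval x (suc s ℕ.+ d) H ≈ 0# → eval x (s ℕ.+ d) (reduce s H) ≈ 0#
    reduce-root s {H} H-degree H-root =
      trans (sym (eval-extend (s ℕ.+ d) (reduce-degree s H-degree) (ℕ.+-monoʳ-≤ s (ℕ.n≤1+n d))))
            (eval-+-root n (eval-*-root n (G d) H-root′) (eval-*-root n (ℤ.- H (s ℕ.+ d)) shift-G-root))
      where
      n = s ℕ.+ suc d
      H-root′ : eval x n H ≈ 0#
      H-root′ = ≡.subst (λ n → eval x n H ≈ 0#) (≡.sym (ℕ.+-suc s d)) H-root
      shift-G-root : eval x n (shift s G) ≈ 0#
      shift-G-root = trans (eval-shift x s (suc d) G) (trans (*-congˡ G-root) (zeroʳ _))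

    pseudoDivide : ∀ s {H} → H HasDegree< s ℕ.+ d → eval x (s ℕ.+ d) H ≈ 0# → s PseudoDivides H
    pseudoDivide zero    {H} H-degree H-root = record
      { scale = 1ℤ ; scale≢0 = λ () ; quotient = λ _ → 0ℤ ; remainder = H
      ; quotient-degree = λ _ _ → ≡.refl ; remainder-degree = H-degree ; remainder-root = H-root
      ; division = λ k → ≡.trans (ℤ.*-identityˡ (H k))
                           (≡.sym (≡.trans (≡.cong (ℤ._+ H k) (zero-⊛ G k)) (ℤ.+-identityˡ (H k)))) }
    pseudoDivide (suc s) {H} H-degree H-root = record
      { scale = scale ℤ.* g ; scale≢0 = scale·g≢0 ; quotient = Q ; remainder = remainder
      ; quotient-degree = Q-degree ; remainder-degree = remainder-degree ; remainder-root = remainder-root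
      ; division = division′ }
      where
      g = G d
      h = H (s ℕ.+ d)
      open _PseudoDivides_ (pseudoDivide s (reduce-degree s H-degree) (reduce-root s H-degree H-root))
      Q : Poly
      Q k = quotient k ℤ.+ scale ℤ.* h ℤ.* (X^ s) k
      scale·g≢0 : scale ℤ.* g ≢ 0ℤ
      scale·g≢0 sg≡0 with ℤ.i*j≡0⇒i≡0∨j≡0 scale sg≡0
      ... | inj₁ scale≡0 = scale≢0 scale≡0
      ... | inj₂ g≡0     = Gd≢0 g≡0
      Q-degree : Q HasDegree< suc s
      Q-degree k s<k = ≡.trans (≡.cong₂ (λ a b → a ℤ.+ scale ℤ.* h ℤ.* b)
                                        (quotient-degree k (ℕ.<⇒≤ s<k)) (X^-degree s k s<k))
                               (≡.trans (ℤ.+-identityˡ _) (ℤ.*-zeroʳ (scale ℤ.* h)))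
      Q⊛G : ∀ k → (Q ⊛ G) k ≡ (quotient ⊛ G) k ℤ.+ scale ℤ.* h ℤ.* shift s G k
      Q⊛G k = ≡.trans (⊛-distribʳ-+ quotient _ G k)
                (≡.cong (ℤ._+_ ((quotient ⊛ G) k))
                        (≡.trans (*-⊛ (scale ℤ.* h) (X^ s) G k) (≡.cong (scale ℤ.* h ℤ.*_) (X^-⊛ s G k))))
      rearrange : ∀ {c g H h S q r} → c ℤ.* (g ℤ.* H ℤ.+ ℤ.- h ℤ.* S) ≡ q ℤ.+ r →
                  c ℤ.* g ℤ.* H ≡ (q ℤ.+ c ℤ.* h ℤ.* S) ℤ.+ r
      rearrange {c} {g} {H} {h} {S} {q} {r} eq =
        ≡.trans (expand c g H h S) (≡.trans (≡.cong (ℤ._+ c ℤ.* h ℤ.* S) eq) (swap q r (c ℤ.* h ℤ.* S)))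
        where
        expand : ∀ c g H h S → c ℤ.* g ℤ.* H ≡ c ℤ.* (g ℤ.* H ℤ.+ ℤ.- h ℤ.* S) ℤ.+ c ℤ.* h ℤ.* S
        expand = solve-∀
        swap : ∀ a b c → a ℤ.+ b ℤ.+ c ≡ a ℤ.+ c ℤ.+ b
        swap = solve-∀
      division′ : ∀ k → scale ℤ.* g ℤ.* H k ≡ (Q ⊛ G) k ℤ.+ remainder k
      division′ k = ≡.trans (rearrange {scale} {g} {H k} {h} {shift s G k} {(quotient ⊛ G) k} {remainder k} (division k))
                            (≡.cong (ℤ._+ remainder k) (≡.sym (Q⊛G k)))

module IntegralDomain (R : CommutativeRing 0ℓ 0ℓ) (domain : IsIntegralDomain R) (char0 : CharZero R) where
  open CommutativeRing R
  open Evaluation R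
  open import Algebra.Properties.Ring ring using (-0#≈0#; -‿involutive)
  open import Relation.Binary.Reasoning.Setoid setoid

  fromℤ≈0⇒≡0 : ∀ z → fromℤ z ≈ 0# → z ≡ 0ℤ
  fromℤ≈0⇒≡0 (+ n)     n≈0 = ≡.cong +_ (char0 n (trans (natR≈·1# n) n≈0))
  fromℤ≈0⇒≡0 -[1+ n ] -n≈0 with char0 (suc n) (trans (natR≈·1# (suc n)) n≈0)
    where n≈0 = trans (sym (-‿involutive _)) (trans (-‿cong -n≈0) -0#≈0#)
  ... | ()

  cancelˡ : ∀ {a b} → ¬ a ≈ 0# → a * b ≈ 0# → b ≈ 0#
  cancelˡ {a} {b} a≉0 ab≈0 with domain a b ab≈0
  ... | inj₁ a≈0 = ⊥-elim (a≉0 a≈0)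
  ... | inj₂ b≈0 = b≈0

  module EisensteinRoot {p} (p-prime : Prime p) {m Ψ} (Ψ-eisenstein : Divisibility.IsEisenstein p p-prime m Ψ)
                        {x} (Ψ-root : eval x (suc m) Ψ ≈ 0#) where
    open Divisibility p p-prime

    Vanishes : ℕ → Set
    Vanishes N = ∀ G → G HasDegree< N → eval x N G ≈ 0# → ∀ k → G k ≡ 0ℤ

    -- Pseudo-dividing Ψ by G leaves a remainder vanishing at x, which is zero
    -- by induction; what is left is a factorisation c Ψ = Q G.
    no-primitive-root : ∀ {d G} → d < m → G HasDegree< suc d → G d ≢ 0ℤ → NonzeroModP G →
                        eval x (suc d) G ≈ 0# → Vanishes d → ⊥
    no-primitive-root {zero} {G} _ _ G0≢0 _ G-root _ =
      G0≢0 (fromℤ≈0⇒≡0 (G 0) (trans (sym (trans (+-congˡ (zeroʳ x)) (+-identityʳ _))) G-root))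
    no-primitive-root {suc d} {G} d<m G-degree Gd≢0 G-nonzero G-root vanishes =
      irreducible Ψ-eisenstein quotient G scale≢0 (s≤s z≤n) d<m G-degree quotient-degree G-nonzero
        (λ k → ≡.sym (≡.trans (division k) (≡.trans (≡.cong (ℤ._+_ ((quotient ⊛ G) k)) (remainder≡0 k)) (ℤ.+-identityʳ _))))
      where
      open PseudoDivision G-degree G-root Gd≢0
      s = suc m ∸ suc d
      s+d≡m+1 : s ℕ.+ suc d ≡ suc m
      s+d≡m+1 = ℕ.m∸n+n≡m (ℕ.<⇒≤ (ℕ.m<n⇒m<1+n d<m))
      Ψ-degree : Ψ HasDegree< s ℕ.+ suc d
      Ψ-degree = ≡.subst (Ψ HasDegree<_) (≡.sym s+d≡m+1) (IsEisenstein.degree Ψ-eisenstein)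
      open _PseudoDivides_ (pseudoDivide s Ψ-degree (≡.subst (λ n → eval x n Ψ ≈ 0#) (≡.sym s+d≡m+1) Ψ-root))
      remainder≡0 : ∀ k → remainder k ≡ 0ℤ
      remainder≡0 = vanishes remainder remainder-degree remainder-root

    /pᶜ-root : ∀ {G} N (p∣G : ∀ k → P ∣ℤ G k) → eval x N G ≈ 0# → eval x N (p∣G /pᶜ) ≈ 0#
    /pᶜ-root {G} N p∣G G-root = cancelˡ P≉0 (begin
      fromℤ P * eval x N G/p             ≈⟨ eval-* x N P G/p ⟨
      eval x N (λ k → P ℤ.* G/p k)       ≈⟨ eval-cong N (λ k → ≡.trans (ℤ.*-comm P (G/p k)) (≡.sym (/p-* (p∣G k)))) ⟩
      eval x N G                         ≈⟨ G-root ⟩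
      0#                                 ∎)
      where
      G/p = p∣G /pᶜ
      P≉0 : ¬ fromℤ P ≈ 0#
      P≉0 P≈0 = ℕ.≢-nonZero⁻¹ p (ℤ.+-injective (fromℤ≈0⇒≡0 P P≈0))

    vanishes : ∀ N → N ≤ m → Vanishes N
    vanishes zero    _   G G-degree _ k = G-degree k z≤n
    vanishes (suc d) d<m G G-degree G-root = go G (<-wellFounded ∣ G d ∣) G-degree G-root
      where
      go : ∀ G → Acc _<_ ∣ G d ∣ → G HasDegree< suc d → eval x (suc d) G ≈ 0# → ∀ k → G k ≡ 0ℤ
      go G (acc rec) G-degree G-root with G d ℤ.≟ 0ℤ
      ... | yes Gd≡0 =
        vanishes d (ℕ.<⇒≤ d<m) G (HasDegree<-suc G-degree Gd≡0)
          (trans (sym (eval-extend d (HasDegree<-suc G-degree Gd≡0) (ℕ.n≤1+n d))) G-root)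
      ... | no Gd≢0 with divisible-or-witness (suc d) G-degree
      ...   | inj₂ G-nonzero = ⊥-elim (no-primitive-root d<m G-degree Gd≢0 G-nonzero G-root (vanishes d (ℕ.<⇒≤ d<m)))
      ...   | inj₁ p∣G = λ k → ≡.trans (/p-* (p∣G k)) (≡.cong (ℤ._* P) (G/p≡0 k))
        where
        G/p≡0 : ∀ k → (p∣G /pᶜ) k ≡ 0ℤ
        G/p≡0 = go (p∣G /pᶜ) (rec (∣/p∣<∣∣ (p∣G d) Gd≢0)) (/pᶜ-degree p∣G G-degree) (/pᶜ-root (suc d) p∣G G-root)

module PrimitiveRoot (R : CommutativeRing 0ℓ 0ℓ) (domain : IsIntegralDomain R) (char0 : CharZero R)
                     {m} (p-prime : Prime (suc m)) {w} (w-root : IsPrimRootOfUnity R (suc m) w) where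
  open CommutativeRing R
  open Evaluation R
  open IntegralDomain R domain char0
  open Divisibility (suc m) p-prime
  open import Relation.Binary.Reasoning.Setoid setoid

  p = suc m

  Φ : Poly
  Φ = geometric p

  Φ-root : eval w p Φ ≈ 0#
  Φ-root = cancelˡ w-1≉0 (trans (eval-geometric w p) (trans (+-congʳ (proj₁ w-root)) (-‿inverseʳ 1#)))
    where
    w-1≉0 : ¬ w - 1# ≈ 0#
    w-1≉0 w-1≈0 = proj₂ w-root (begin
      w               ≈⟨ +-identityʳ w ⟨
      w + 0#          ≈⟨ +-congˡ (-‿inverseˡ 1#) ⟨
      w + (- 1# + 1#) ≈⟨ +-assoc w (- 1#) 1# ⟨
      w - 1# + 1#     ≈⟨ +-congʳ w-1≈0 ⟩
      0# + 1#         ≈⟨ +-identityˡ 1# ⟩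
      1#              ∎)

  Ψ : Poly
  Ψ = translate p Φ

  Ψ-eisenstein : IsEisenstein m Ψ
  Ψ-eisenstein = record
    { constant = ≡.trans (translate-geometric p 0) (≡.cong +_ (nC1≡n p))
    ; middle   = λ j j<m → ≡.subst (P ∣ℤ_) (≡.sym (translate-geometric p j))
                             (ℤ∣.∣ᵤ⇒∣ (prime∣C p-prime (s≤s z≤n) (s≤s j<m)))
    ; leading  = λ p∣Ψm → ℕ.<-irrefl ≡.refl (ℕ.<-≤-trans p>1
                   (ℕ∣.∣⇒≤ (≡.subst (p ℕ∣.∣_) (nCn≡1 p) (ℤ∣.∣⇒∣ᵤ (≡.subst (P ∣ℤ_) (translate-geometric p m) p∣Ψm)))))
    ; degree   = translate-degree p Φ
    }

  x : Carrier
  x = w - 1#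

  x+1≈w : x + 1# ≈ w
  x+1≈w = trans (+-assoc w (- 1#) 1#) (trans (+-congˡ (-‿inverseˡ 1#)) (+-identityʳ w))

  Ψ-root : eval x p Ψ ≈ 0#
  Ψ-root = trans (eval-translate x p Φ) (trans (eval-congˡ p Φ x+1≈w) Φ-root)

  open EisensteinRoot p-prime Ψ-eisenstein Ψ-root

  -- Subtracting F m · Φ leaves a polynomial of degree < m vanishing at w;
  -- translated by one it vanishes at x, hence is zero.
  module _ {F} (F-degree : F HasDegree< p) (F-root : eval w p F ≈ 0#) where
    F′ : Poly
    F′ k = F k ℤ.+ ℤ.- F m ℤ.* Φ k

    F′-degree : F′ HasDegree< m
    F′-degree = HasDegree<-suc below top
      where
      below : F′ HasDegree< p
      below k p≤k = ≡.trans (≡.cong₂ (λ a b → a ℤ.+ ℤ.- F m ℤ.* b) (F-degree k p≤k) (geometric-degree p k p≤k))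
                            (≡.trans (ℤ.+-identityˡ _) (ℤ.*-zeroʳ (ℤ.- F m)))
      cancel : ∀ e → e ℤ.+ ℤ.- e ℤ.* 1ℤ ≡ 0ℤ
      cancel = solve-∀
      top : F′ m ≡ 0ℤ
      top = ≡.trans (≡.cong (λ t → F m ℤ.+ ℤ.- F m ℤ.* t) (geometric-< (ℕ.n<1+n m))) (cancel (F m))

    F′-root : eval w m F′ ≈ 0#
    F′-root = trans (sym (eval-extend m F′-degree (ℕ.n≤1+n m)))
                    (eval-+-root p {F} {λ k → ℤ.- F m ℤ.* Φ k} F-root (eval-*-root p (ℤ.- F m) {Φ} Φ-root))

    F′≡0 : ∀ k → k < m → F′ k ≡ 0ℤ
    F′≡0 = translate-injective m F′ (vanishes m ℕ.≤-refl (translate m F′) (translate-degree m F′) translated-root)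
      where
      translated-root : eval x m (translate m F′) ≈ 0#
      translated-root = trans (eval-translate x m F′) (trans (eval-congˡ m F′ x+1≈w) F′-root)

  root-coefficients-equal : ∀ F → F HasDegree< p → eval w p F ≈ 0# → ∀ j → j < p → F j ≡ F m
  root-coefficients-equal F F-degree F-root j j<p with ℕ.m≤n⇒m<n∨m≡n (ℕ.≤-pred j<p)
  ... | inj₂ ≡.refl = ≡.refl
  ... | inj₁ j<m    = ≡.trans (sym-cancel (F j) (F m))
                        (≡.trans (≡.cong (λ t → F j ℤ.+ ℤ.- F m ℤ.* t ℤ.+ F m) (≡.sym (geometric-< j<p)))
                                 (≡.trans (≡.cong (ℤ._+ F m) (F′≡0 F-degree F-root j j<m)) (ℤ.+-identityˡ (F m))))
    where
    sym-cancel : ∀ a e → a ≡ a ℤ.+ ℤ.- e ℤ.* 1ℤ ℤ.+ e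
    sym-cancel = solve-∀

module Words where
  open import Data.Nat using (_+_; _*_; _^_; _!)
  open ≡ using (refl; sym; trans; cong; cong₂; subst; module ≡-Reasoning)

  sum-const : ∀ n c → ∑[ i < n ] c ≡ n * c
  sum-const zero    c = refl
  sum-const (suc n) c = cong (_+_ c) (sum-const n c)

  sum-mono-≤ : ∀ {n} {f g : Vector ℕ n} → (∀ i → f i ≤ g i) → sum f ≤ sum g
  sum-mono-≤ {zero}  f≤g = z≤n
  sum-mono-≤ {suc n} f≤g = ℕ.+-mono-≤ (f≤g zero) (sum-mono-≤ (f≤g ∘ suc))

  -- the cyclic successor i ↦ i + 1 (mod k + 1)
  rotate : ∀ {k} → Fin (suc k) → Fin (suc k)
  rotate {zero}  zero    = zero
  rotate {suc k} zero    = suc zero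
  rotate {suc k} (suc i) = suc-unless-wrapped (rotate i)
    where
    suc-unless-wrapped : Fin (suc k) → Fin (suc (suc k))
    suc-unless-wrapped zero    = zero
    suc-unless-wrapped (suc j) = suc (suc j)

  rotate-inject₁ : ∀ {k} (i : Fin k) → rotate (inject₁ i) ≡ suc i
  rotate-inject₁ {suc k} zero    = refl
  rotate-inject₁ {suc k} (suc i) rewrite rotate-inject₁ i = refl

  rotate-fromℕ : ∀ k → rotate (fromℕ k) ≡ zero
  rotate-fromℕ zero    = refl
  rotate-fromℕ (suc k) rewrite rotate-fromℕ k = refl

  inject₁-or-fromℕ : ∀ {k} (i : Fin (suc k)) → Σ (Fin k) (λ j → i ≡ inject₁ j) ⊎ i ≡ fromℕ k
  inject₁-or-fromℕ {zero}  zero    = inj₂ refl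
  inject₁-or-fromℕ {suc k} zero    = inj₁ (zero , refl)
  inject₁-or-fromℕ {suc k} (suc i) with inject₁-or-fromℕ i
  ... | inj₁ (j , i≡j) = inj₁ (suc j , cong suc i≡j)
  ... | inj₂ i≡last    = inj₂ (cong suc i≡last)

  sum-rotate : ∀ {k} (f : Vector ℕ (suc k)) → ∑[ a < suc k ] f (rotate a) ≡ sum f
  sum-rotate {k} f = begin
    ∑[ a < suc k ] f (rotate a)                                  ≡⟨ sum-init-last (f ∘ rotate) ⟩
    ∑[ i < k ] f (rotate (inject₁ i)) + f (rotate (fromℕ k))
      ≡⟨ cong₂ _+_ (sum-cong-≗ (cong f ∘ rotate-inject₁)) (cong f (rotate-fromℕ k)) ⟩
    ∑[ i < k ] f (suc i) + f zero                                ≡⟨ ℕ.+-comm _ (f zero) ⟩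
    sum f                                                        ∎
    where open ≡-Reasoning

  rotate^ : ∀ {k} → ℕ → Fin (suc k) → Fin (suc k)
  rotate^ zero    = λ a → a
  rotate^ (suc n) = rotate ∘ rotate^ n

  sum-rotate^ : ∀ {k} n (f : Vector ℕ (suc k)) → ∑[ a < suc k ] f (rotate^ n a) ≡ sum f
  sum-rotate^ zero    f = refl
  sum-rotate^ (suc n) f = trans (sum-rotate^ n (f ∘ rotate)) (sum-rotate f)

  -- addition in ℤ/(k + 1)
  _⊕_ : ∀ {k} → Fin (suc k) → Fin (suc k) → Fin (suc k)
  a ⊕ b = rotate^ (toℕ a) b

  module Counting (p : ℕ) where

    count : ∀ n → (Vector (Fin p) n → Bool) → ℕ
    count zero    P = if P [] then 1 else 0
    count (suc n) P = ∑[ a < p ] count n (λ u → P (a ∷ u))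

    count-cong : ∀ n {P Q} → (∀ u → P u ≡ Q u) → count n P ≡ count n Q
    count-cong zero    P≗Q = cong (if_then 1 else 0) (P≗Q [])
    count-cong (suc n) P≗Q = sum-cong-≗ (λ a → count-cong n (λ u → P≗Q (a ∷ u)))

    count-false : ∀ n → count n (λ _ → false) ≡ 0
    count-false zero    = refl
    count-false (suc n) = trans (sum-cong-≗ {p} {y = λ _ → 0} (λ _ → count-false n)) (trans (sum-const p 0) (ℕ.*-zeroʳ p))

    count-true : ∀ n → count n (λ _ → true) ≡ p ^ n
    count-true zero    = refl
    count-true (suc n) = trans (sum-cong-≗ {p} {y = λ _ → p ^ n} (λ _ → count-true n)) (sum-const p (p ^ n))

    count-mono : ∀ n {P Q} → (∀ u → T (P u) → T (Q u)) → count n P ≤ count n Q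
    count-mono zero {P} {Q} P⇒Q with P [] | Q [] | P⇒Q []
    ... | false | _     | _    = z≤n
    ... | true  | true  | _    = ℕ.≤-refl
    ... | true  | false | ⇒ff = ⊥-elim (⇒ff tt)
    count-mono (suc n) P⇒Q = sum-mono-≤ (λ a → count-mono n (λ u → P⇒Q (a ∷ u)))

    count-∨ : ∀ n P Q → count n (λ u → P u ∨ Q u) ≤ count n P + count n Q
    count-∨ zero P Q with P [] | Q []
    ... | true  | _     = s≤s z≤n
    ... | false | true  = ℕ.≤-refl
    ... | false | false = z≤n
    count-∨ (suc n) P Q = ℕ.≤-trans (sum-mono-≤ (λ a → count-∨ n (λ u → P (a ∷ u)) (λ u → Q (a ∷ u))))
                                     (ℕ.≤-reflexive (∑-distrib-+ (λ a → count n (λ u → P (a ∷ u)))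
                                                                 (λ a → count n (λ u → Q (a ∷ u)))))

    any : ∀ k → (Fin k → Bool) → Bool
    any zero    B = false
    any (suc k) B = B zero ∨ any k (B ∘ suc)

    any-intro : ∀ {k} (B : Fin k → Bool) j → T (B j) → T (any k B)
    any-intro B zero    Bj with B zero
    ... | true = tt
    any-intro B (suc j) Bj with B zero
    ... | true  = tt
    ... | false = any-intro (B ∘ suc) j Bj

    count-any : ∀ n k (B : Fin k → Vector (Fin p) n → Bool) →
                count n (λ u → any k (λ j → B j u)) ≤ ∑[ j < k ] count n (B j)
    count-any n zero    B = ℕ.≤-reflexive (count-false n)
    count-any n (suc k) B = ℕ.≤-trans (count-∨ n _ _) (ℕ.+-monoʳ-≤ (count n (B zero)) (count-any n k (B ∘ suc)))

  indicator : ℕ → ℕ → ℕ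
  indicator b j = if b ≡ᵇ j then 1 else 0

  remove : ℕ → (ℕ → ℕ) → ℕ → ℕ
  remove b c j = c j ∸ indicator b j

  all< : ℕ → (ℕ → Bool) → Bool
  all< zero    P = true
  all< (suc N) P = P 0 ∧ all< N (P ∘ suc)

  all<-intro : ∀ N P → (∀ j → j < N → T (P j)) → T (all< N P)
  all<-intro zero    P h = tt
  all<-intro (suc N) P h with P 0 | h 0 (s≤s z≤n)
  ... | true | _ = all<-intro N (P ∘ suc) (λ j j<N → h (suc j) (s≤s j<N))

  positive? : ℕ → Bool
  positive? zero    = false
  positive? (suc _) = true

  +indicator≡ᵇ : ∀ N b (X c : ℕ → ℕ) → b < N →
                 all< N (λ j → (indicator b j + X j) ≡ᵇ c j) ≡ positive? (c b) ∧ all< N (λ j → X j ≡ᵇ remove b c j)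
  +indicator≡ᵇ (suc N) zero    X c _ with c 0
  ... | zero  = refl
  ... | suc _ = refl
  +indicator≡ᵇ (suc N) (suc b) X c (s≤s b<N) =
    trans (cong ((X 0 ≡ᵇ c 0) ∧_) (+indicator≡ᵇ N b (X ∘ suc) (c ∘ suc) b<N)) (swap (X 0 ≡ᵇ c 0) (c (suc b)))
    where
    swap : ∀ A g {B} → A ∧ (positive? g ∧ B) ≡ positive? g ∧ (A ∧ B)
    swap A zero    = ∧-zeroʳ A
    swap A (suc g) = refl

  ∏! : ℕ → (ℕ → ℕ) → ℕ
  ∏! zero    c = 1
  ∏! (suc N) c = c 0 ! * ∏! N (c ∘ suc)

  ∏!-const : ∀ N c → ∏! N (λ _ → c) ≡ (c !) ^ N
  ∏!-const zero    c = refl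
  ∏!-const (suc N) c = cong (c ! *_) (∏!-const N c)

  ∏!-zero : ∀ N (c : ℕ → ℕ) → (∀ j → j < N → c j ≡ 0) → ∏! N c ≡ 1
  ∏!-zero zero    c _   = refl
  ∏!-zero (suc N) c c≡0 =
    cong₂ (λ x y → x ! * y) (c≡0 0 (s≤s z≤n)) (∏!-zero N (c ∘ suc) (λ j j<N → c≡0 (suc j) (s≤s j<N)))

  ∏!-remove : ∀ N (c : ℕ → ℕ) {b} → b < N → 0 < c b → ∏! N c ≡ c b * ∏! N (remove b c)
  ∏!-remove (suc N) c {zero} _ 0<c₀ with c 0
  ... | suc c₀ = ℕ.*-assoc (suc c₀) (c₀ !) _
  ∏!-remove (suc N) c {suc b} (s≤s b<N) 0<cb = begin
    c 0 ! * ∏! N (c ∘ suc)                          ≡⟨ cong (c 0 ! *_) (∏!-remove N (c ∘ suc) b<N 0<cb) ⟩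
    c 0 ! * (c (suc b) * ∏! N (remove b (c ∘ suc)))  ≡⟨ x∙yz≈y∙xz (c 0 !) (c (suc b)) _ ⟩
    c (suc b) * (c 0 ! * ∏! N (remove b (c ∘ suc)))  ∎
    where open ≡-Reasoning

  ∑-remove : ∀ N (c : ℕ → ℕ) {b} → b < N → 0 < c b → ∑[ j < N ] c (toℕ j) ≡ suc (∑[ j < N ] remove b c (toℕ j))
  ∑-remove (suc N) c {zero} _ 0<c₀ with c 0
  ... | suc c₀ = refl
  ∑-remove (suc N) c {suc b} (s≤s b<N) 0<cb =
    trans (cong (_+_ (c 0)) (∑-remove N (c ∘ suc) b<N 0<cb)) (ℕ.+-suc (c 0) _)

  ∑≡0 : ∀ N (c : ℕ → ℕ) → ∑[ j < N ] c (toℕ j) ≡ 0 → ∀ j → j < N → c j ≡ 0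
  ∑≡0 (suc N) c ∑c≡0 zero    _         = ℕ.m+n≡0⇒m≡0 (c 0) ∑c≡0
  ∑≡0 (suc N) c ∑c≡0 (suc j) (s≤s j<N) = ∑≡0 N (c ∘ suc) (ℕ.m+n≡0⇒n≡0 (c 0) ∑c≡0) j j<N

  ∑-indicator : ∀ N {b} → b < N → ∑[ j < N ] indicator b (toℕ j) ≡ 1
  ∑-indicator (suc N) {zero}  _         =
    cong suc (trans (sum-cong-≗ {N} {y = λ _ → 0} (λ _ → refl)) (trans (sum-const N 0) (ℕ.*-zeroʳ N)))
  ∑-indicator (suc N) {suc b} (s≤s b<N) = ∑-indicator N b<N

  module Histogram (m : ℕ) where
    p = suc m
    open Counting p

    histogram : ∀ {n} → Vector (Fin p) n → ℕ → ℕ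
    histogram {zero}  a j = 0
    histogram {suc n} a j = indicator (toℕ (a zero)) j + histogram (a ∘ suc) j

    _matches_ : (ℕ → ℕ) → (ℕ → ℕ) → Bool
    h matches c = all< p (λ j → h j ≡ᵇ c j)

    multinomial : ∀ n (v : Vector (Fin p) n) c → ∑[ j < p ] c (toℕ j) ≡ n →
                  count n (λ u → histogram (zipWith _⊕_ v u) matches c) * ∏! p c ≡ n !
    multinomial zero v c ∑c≡0 = cong₂ _*_ count≡1 ∏!≡1
      where
      c≡0 = ∑≡0 p c ∑c≡0
      count≡1 : count zero (λ u → histogram (zipWith _⊕_ v u) matches c) ≡ 1
      count≡1 with (λ (j : ℕ) → 0) matches c
                 | all<-intro p (λ j → 0 ≡ᵇ c j) (λ j j<p → ℕ.≡⇒≡ᵇ 0 (c j) (sym (c≡0 j j<p)))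
      ... | true | _ = refl
      ∏!≡1 : ∏! p c ≡ 1
      ∏!≡1 = ∏!-zero p c c≡0
    multinomial (suc n) v c ∑c≡1+n = begin
      (∑[ a < p ] count n (λ u → histogram (zipWith _⊕_ v (a ∷ u)) matches c)) * ∏! p c
        ≡⟨ cong (_* ∏! p c) (sum-cong-≗ {p} first-letter) ⟩
      (∑[ a < p ] N (toℕ (rotate^ (toℕ (v zero)) a))) * ∏! p c
        ≡⟨ cong (_* ∏! p c) (sum-rotate^ (toℕ (v zero)) (N ∘ toℕ)) ⟩
      (∑[ a < p ] N (toℕ a)) * ∏! p c
        ≡⟨ *-distribʳ-sum {p} (∏! p c) (N ∘ toℕ) ⟩
      ∑[ a < p ] (N (toℕ a) * ∏! p c)
        ≡⟨ sum-cong-≗ {p} (λ a → last-letter (toℕ a) (Fin.toℕ<n a)) ⟩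
      ∑[ a < p ] (c (toℕ a) * n !)
        ≡⟨ *-distribʳ-sum {p} (n !) (c ∘ toℕ) ⟨
      (∑[ a < p ] c (toℕ a)) * n !
        ≡⟨ cong (_* n !) ∑c≡1+n ⟩
      suc n !                                                               ∎
      where
      open ≡-Reasoning
      v′ = v ∘ suc
      -- the tails u after a first letter a with toℕ (v zero ⊕ a) ≡ b
      N : ℕ → ℕ
      N b = count n (λ u → positive? (c b) ∧ (histogram (zipWith _⊕_ v′ u) matches remove b c))
      first-letter : ∀ a → count n (λ u → histogram (zipWith _⊕_ v (a ∷ u)) matches c) ≡ N (toℕ (v zero ⊕ a))
      first-letter a = count-cong n (λ u → +indicator≡ᵇ p (toℕ (v zero ⊕ a)) (histogram (zipWith _⊕_ v′ u)) c (Fin.toℕ<n _))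
      last-letter : ∀ b → b < p → N b * ∏! p c ≡ c b * n !
      last-letter b b<p = by-value (c b) refl
        where
        M = count n (λ u → histogram (zipWith _⊕_ v′ u) matches remove b c)
        by-value : ∀ g → c b ≡ g →
                   count n (λ u → positive? g ∧ (histogram (zipWith _⊕_ v′ u) matches remove b c)) * ∏! p c ≡ g * n !
        by-value zero    _   = cong (_* ∏! p c) (count-false n)
        by-value (suc k) cb≡ = begin
          M * ∏! p c                        ≡⟨ cong (M *_) (∏!-remove p c b<p 0<cb) ⟩
          M * (c b * ∏! p (remove b c))     ≡⟨ x∙yz≈y∙xz M (c b) _ ⟩
          c b * (M * ∏! p (remove b c))     ≡⟨ cong₂ _*_ cb≡ (multinomial n v′ (remove b c) ∑remove≡n) ⟩
          suc k * n !                       ∎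
          where
          0<cb : 0 < c b
          0<cb = subst (0 <_) (sym cb≡) (s≤s z≤n)
          ∑remove≡n : ∑[ j < p ] remove b c (toℕ j) ≡ n
          ∑remove≡n = ℕ.suc-injective (trans (sym (∑-remove p c b<p 0<cb)) ∑c≡1+n)

open Words

module Orthogonality (R : CommutativeRing 0ℓ 0ℓ) (domain : IsIntegralDomain R) (char0 : CharZero R)
                     {m} (p-prime : Prime (suc m)) {w} (w-root : IsPrimRootOfUnity R (suc m) w) where
  open CommutativeRing R hiding (zero)
  open Evaluation R
  open PrimitiveRoot R domain char0 p-prime w-root using (root-coefficients-equal)
  open Histogram m
  open Counting p
  open import Relation.Binary.Reasoning.Setoid setoid

  powʷ : ℕ → Carrier
  powʷ = pow R w

  powʷ-rotate : ∀ (i : Fin p) → powʷ (toℕ (rotate i)) ≈ w * powʷ (toℕ i)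
  powʷ-rotate i with inject₁-or-fromℕ i
  ... | inj₁ (j , ≡.refl) = reflexive (≡.trans (≡.cong (powʷ ∘ toℕ) (rotate-inject₁ j))
                                               (≡.cong (λ t → w * powʷ t) (≡.sym (Fin.toℕ-inject₁ j))))
  ... | inj₂ ≡.refl = begin
    powʷ (toℕ (rotate (fromℕ m)))  ≡⟨ ≡.cong (powʷ ∘ toℕ) (rotate-fromℕ m) ⟩
    1#                             ≈⟨ proj₁ w-root ⟨
    w * powʷ m                     ≡⟨ ≡.cong (λ t → w * powʷ t) (Fin.toℕ-fromℕ m) ⟨
    w * powʷ (toℕ (fromℕ m))       ∎

  powʷ-⊕ : ∀ (a b : Fin p) → powʷ (toℕ (a ⊕ b)) ≈ powʷ (toℕ a) * powʷ (toℕ b)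
  powʷ-⊕ a b = go (toℕ a) b
    where
    go : ∀ k (b : Fin p) → powʷ (toℕ (rotate^ k b)) ≈ powʷ k * powʷ (toℕ b)
    go zero    b = sym (*-identityˡ _)
    go (suc k) b = trans (powʷ-rotate (rotate^ k b)) (trans (*-congˡ (go k b)) (sym (*-assoc _ _ _)))

  eval-indicator : ∀ N {b} → b < N → eval w N (λ j → + indicator b j) ≈ powʷ b
  eval-indicator (suc N) {zero}  _ =
    trans (+-cong fromℤ-1 (trans (*-congˡ (eval-zero N (λ _ → ≡.refl))) (zeroʳ w))) (+-identityʳ 1#)
  eval-indicator (suc N) {suc b} (s≤s b<N) = trans (+-identityˡ _) (*-congˡ (eval-indicator N b<N))

  HistogramPoly : ∀ {n} → Vector (Fin p) n → Poly
  HistogramPoly a j = + histogram a j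

  inner≈eval-histogram : ∀ {n} (v u : Vector (Fin p) n) → inner R w v u ≈ eval w p (HistogramPoly (zipWith _⊕_ v u))
  inner≈eval-histogram {zero}  v u = sym (eval-zero p (λ _ → ≡.refl))
  inner≈eval-histogram {suc n} v u = sym (begin
    eval w p (λ j → + (indicator b j ℕ.+ histogram (zipWith _⊕_ v′ u′) j))
      ≈⟨ eval-cong p (λ j → ℤ.pos-+ (indicator b j) (histogram (zipWith _⊕_ v′ u′) j)) ⟩
    eval w p (λ j → + indicator b j ℤ.+ HistogramPoly (zipWith _⊕_ v′ u′) j)
      ≈⟨ eval-+ w p (λ j → + indicator b j) (HistogramPoly (zipWith _⊕_ v′ u′)) ⟩
    eval w p (λ j → + indicator b j) + eval w p (HistogramPoly (zipWith _⊕_ v′ u′))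
      ≈⟨ +-cong (trans (eval-indicator p (Fin.toℕ<n (v zero ⊕ u zero))) (powʷ-⊕ (v zero) (u zero)))
                (sym (inner≈eval-histogram v′ u′)) ⟩
    inner R w v u ∎)
    where
    b = toℕ (v zero ⊕ u zero)
    v′ = v ∘ suc
    u′ = u ∘ suc

  histogram-degree : ∀ {n} (a : Vector (Fin p) n) → HistogramPoly a HasDegree< p
  histogram-degree {zero}  a k _   = ≡.refl
  histogram-degree {suc n} a k p≤k =
    ≡.cong +_ (≡.cong₂ ℕ._+_ (indicator-< (ℕ.<-≤-trans (Fin.toℕ<n (a zero)) p≤k))
                             (ℤ.+-injective (histogram-degree (a ∘ suc) k p≤k)))
    where
    indicator-< : ∀ {b k} → b < k → indicator b k ≡ 0
    indicator-< {zero}  {suc k} _         = ≡.refl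
    indicator-< {suc b} {suc k} (s≤s b<k) = indicator-< b<k

  ∑-histogram : ∀ {n} (a : Vector (Fin p) n) → ∑[ j < p ] histogram a (toℕ j) ≡ n
  ∑-histogram {zero}  a = ≡.trans (sum-const p 0) (ℕ.*-zeroʳ p)
  ∑-histogram {suc n} a =
    ≡.trans (∑-distrib-+ {p} (λ j → indicator (toℕ (a zero)) (toℕ j)) (λ j → histogram (a ∘ suc) (toℕ j)))
                                  (≡.cong₂ ℕ._+_ (∑-indicator p (Fin.toℕ<n (a zero))) (∑-histogram (a ∘ suc)))

  -- All p counts coincide by root-coefficients-equal, and they add up to n = q p.
  orthogonal⇒balanced : ∀ {n} q → n ≡ q ℕ.* p → (v u : Vector (Fin p) n) → inner R w v u ≈ 0# →
                        T (histogram (zipWith _⊕_ v u) matches (λ _ → q))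
  orthogonal⇒balanced {n} q n≡qp v u v·u≈0 =
    all<-intro p _ (λ j j<p → ℕ.≡⇒≡ᵇ _ _ (≡.trans (count-equal j j<p) E≡q))
    where
    h = histogram (zipWith _⊕_ v u)
    E = h m
    count-equal : ∀ j → j < p → h j ≡ E
    count-equal j j<p = ℤ.+-injective (root-coefficients-equal (HistogramPoly (zipWith _⊕_ v u))
                          (histogram-degree (zipWith _⊕_ v u)) (trans (sym (inner≈eval-histogram v u)) v·u≈0) j j<p)
    E≡q : E ≡ q
    E≡q = ℕ.*-cancelˡ-≡ E q p (≡.trans (≡.sym (sum-const p E))
            (≡.trans (sum-cong-≗ {p} (λ j → ≡.sym (count-equal (toℕ j) (Fin.toℕ<n j))))
              (≡.trans (∑-histogram (zipWith _⊕_ v u)) (≡.trans n≡qp (ℕ.*-comm q p)))))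

module CoveringBound (R : CommutativeRing 0ℓ 0ℓ) (domain : IsIntegralDomain R) (char0 : CharZero R)
                     {m} (p-prime : Prime (suc m)) {w} (w-root : IsPrimRootOfUnity R (suc m) w) where
  open import Data.Nat using (_+_; _*_; _^_; _≤_; _!)
  open Orthogonality R domain char0 p-prime w-root
  open Histogram m
  open Counting p

  -- Each v_j is orthogonal to at most n! / (q!)^p words, and every word is
  -- orthogonal to some v_j.
  covering-bound : ∀ {n} q → n ≡ q * p → ∀ k (V : Fin k → Bvec R n p) → IsCovering R w n p k V →
                   p ^ n * (q !) ^ p ≤ k * n !
  covering-bound {n} q n≡qp k V covering = begin
    p ^ n * (q !) ^ p                             ≡⟨ ≡.cong₂ _*_ (≡.sym (count-true n)) (≡.sym (∏!-const p q)) ⟩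
    count n (λ _ → true) * ∏! p cq                ≤⟨ ℕ.*-monoˡ-≤ (∏! p cq) (count-mono n (λ u _ → covered u)) ⟩
    count n (λ u → any k (λ j → Balanced j u)) * ∏! p cq
                                                  ≤⟨ ℕ.*-monoˡ-≤ (∏! p cq) (count-any n k Balanced) ⟩
    (∑[ j < k ] count n (Balanced j)) * ∏! p cq   ≡⟨ *-distribʳ-sum {k} (∏! p cq) (λ j → count n (Balanced j)) ⟩
    ∑[ j < k ] (count n (Balanced j) * ∏! p cq)   ≡⟨ sum-cong-≗ {k} (λ j → multinomial n (V j) cq ∑cq≡n) ⟩
    ∑[ j < k ] (n !)                              ≡⟨ sum-const k (n !) ⟩
    k * n !                                       ∎
    where
    open ℕ.≤-Reasoning
    cq : ℕ → ℕ
    cq _ = q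
    Balanced : Fin k → Vector (Fin p) n → Bool
    Balanced j u = histogram (zipWith _⊕_ (V j) u) matches cq
    ∑cq≡n : ∑[ j < p ] cq (toℕ j) ≡ n
    ∑cq≡n = ≡.trans (sum-const p q) (≡.trans (ℕ.*-comm p q) (≡.sym n≡qp))
    covered : ∀ u → T (any k (λ j → Balanced j u))
    covered u with covering u
    ... | j , Vj·u≈0 = any-intro (λ j → Balanced j u) j (orthogonal⇒balanced q n≡qp (V j) u Vj·u≈0)

open import Data.Nat using (_*_; _^_; _!)
open import Data.Nat.Divisibility using (_∣_; quotient)

proposition4p1 : (R : CommutativeRing 0ℓ 0ℓ) → IsIntegralDomain R → CharZero R →
    (p n : ℕ) → Prime p → (d : p ∣ n) → 0 < n →
    (w : CommutativeRing.Carrier R) → IsPrimRootOfUnity R p w →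
    (k : ℕ) (V : Fin k → Bvec R n p) → IsCovering R w n p k V →
    (p ^ n) * ((quotient d !) ^ p) ≤ k * (n !)
proposition4p1 R domain char0 zero    n ()
proposition4p1 R domain char0 (suc m) n p-prime d _ w w-root k V covering =
  CoveringBound.covering-bound R domain char0 p-prime w-root (quotient d) (ℕ∣._∣_.equality d) k V covering
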